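{- (Catalan's identity) Let $k,a,b$ be positive real numbers. For any integers $n\ge r\ge0$, $S_{k,n-r}^{(a,b)}S_{k,n+r}^{(a,b)}-\big(S_{k,n}^{(a,b)}\big)^2=(-1)^{n-r+1}\{a^2-(k^2+4)b^2\}F_{k,r}^2.$
   Context: The $k$-Fibonacci numbers are $F_{k,0}=0$, $F_{k,1}=1$, $F_{k,n}=kF_{k,n-1}+F_{k,n-2}$. The $k$-FL sequence is $S_{k,0}^{(a,b)}=2b$, $S_{k,1}^{(a,b)}=bk+a$, $S_{k,n}^{(a,b)}=kS_{k,n-1}^{(a,b)}+S_{k,n-2}^{(a,b)}$ for $n\ge2$. -}

module Defs where

open import Level using (Level)
open import Data.Nat using (ℕ; zero; suc)
open import Algebra.Bundles using (CommutativeRing)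

-- k-Fibonacci and k-FL sequences, interpreted in an arbitrary commutative ring R.
module KSeq {c ℓ : Level} (R : CommutativeRing c ℓ) where
  open CommutativeRing R

  F : Carrier → ℕ → Carrier
  F k zero = 0#
  F k (suc zero) = 1#
  F k (suc (suc n)) = k * F k (suc n) + F k n

  S : Carrier → Carrier → Carrier → ℕ → Carrier
  S k a b zero = (1# + 1#) * b
  S k a b (suc zero) = b * k + a
  S k a b (suc (suc n)) = k * S k a b (suc n) + S k a b n

  negOnePow : ℕ → Carrier
  negOnePow zero = 1#
  negOnePow (suc m) = (- 1#) * negOnePow m

  four : Carrier
  four = 1# + 1# + 1# + 1#

module Submission where

-- The argument works for every sequence G obeying the k-Fibonacci recurrence
-- G(n+2) = k G(n+1) + G(n), and has three ingredients:
--   * the addition formula  G(j+1+m) = F(j+1) G(m+1) + F(j) G(m),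
--     which expresses a shifted term through the two consecutive terms
--     x = G(m), y = G(m+1);
--   * the Cassini form  Q(y, x) = y² - (k y + x) x  of consecutive terms,
--     which changes sign at each step, so  Q(G(m+1), G(m)) = (-1)^m Q(G 1, G 0);
--   * a polynomial identity showing that, after the addition formula is
--     applied, G(m) G(m+2r) - G(m+r)² collapses to  -F(r)² Q(y, x).
-- Hence G(m) G(m+2r) - G(m+r)² = (-1)^(m+1) Q(G 1, G 0) F(r)²; for G = S the
-- initial value Q(S 1, S 0) is the discriminant a² - (k² + 4) b², and writing
-- m = n - r gives the theorem.

open import Defs
open import Level using (Level)
open import Data.Nat using (ℕ; zero; suc; _≤_; _∸_) renaming (_+_ to _+ℕ_)
open import Data.Nat.Properties using (m+[n∸m]≡n) renaming (+-comm to +ℕ-comm)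
open import Algebra.Bundles using (CommutativeRing)
open import Relation.Binary.PropositionalEquality using (_≡_; cong; subst₂) renaming (trans to ≡-trans)
import Relation.Binary.Reasoning.Setoid as SetoidReasoning
import Algebra.Properties.Ring as RingProperties
import Algebra.Properties.CommutativeSemigroup as CommutativeSemigroupProperties
import Algebra.Solver.Ring.NaturalCoefficients.Default as SemiringSolver

module CatalanIdentity {c ℓ : Level} (R : CommutativeRing c ℓ) where
  open CommutativeRing R
  open KSeq R
  open RingProperties ring
    using (x∙y⁻¹≈ε⇒x≈y; x≈y⇒x∙y⁻¹≈ε; ⁻¹-anti-homo‿-; -‿+-comm; -‿distribˡ-*;
           [y-z]x≈yx-zx; -1*x≈-x)
  open CommutativeSemigroupProperties +-commutativeSemigroup using (interchange)
  open SemiringSolver commutativeSemiring using (solve; _:=_; _:+_; _:*_; con)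
  open SetoidReasoning setoid

  -- A difference equation proved additively: this reduces every identity
  -- involving subtraction to a negation-free one the semiring solver can check.
  diff-transfer : ∀ {a b c d} → a + d ≈ c + b → a - b ≈ c - d
  diff-transfer {a} {b} {c} {d} a+d≈c+b = x∙y⁻¹≈ε⇒x≈y (a - b) (c - d) (begin
    (a - b) - (c - d)    ≈⟨ +-congˡ (⁻¹-anti-homo‿- c d) ⟩
    (a - b) + (d - c)    ≈⟨ interchange a (- b) d (- c) ⟩
    (a + d) + (- b - c)  ≈⟨ +-congˡ (-‿+-comm b c) ⟩
    (a + d) - (b + c)    ≈⟨ x≈y⇒x∙y⁻¹≈ε (trans a+d≈c+b (+-comm c b)) ⟩
    0#                   ∎)

  negOnePow-suc : ∀ m x → negOnePow (suc m) * x ≈ - (negOnePow m * x)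
  negOnePow-suc m x = trans (*-assoc (- 1#) (negOnePow m) x) (-1*x≈-x (negOnePow m * x))

  Recurrent : Carrier → (ℕ → Carrier) → Set ℓ
  Recurrent k G = ∀ n → G (suc (suc n)) ≈ k * G (suc n) + G n

  addition-formula : ∀ {k G} → Recurrent k G → ∀ j m →
    G (suc j +ℕ m) ≈ F k (suc j) * G (suc m) + F k j * G m
  addition-formula {G = G} rec zero m =
    solve 2 (λ y x → y := con 1 :* y :+ con 0 :* x) refl (G (suc m)) (G m)
  addition-formula {k} {G} rec (suc zero) m = begin
    G (suc (suc m))                            ≈⟨ rec m ⟩
    k * G (suc m) + G m                        ≈⟨ solve 3 (λ k y x → k :* y :+ x
                                                    := (k :* con 1 :+ con 0) :* y :+ con 1 :* x)
                                                    refl k (G (suc m)) (G m) ⟩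
    (k * 1# + 0#) * G (suc m) + 1# * G m       ∎
  addition-formula {k} {G} rec (suc (suc j)) m = begin
    G (suc (suc (suc j +ℕ m)))
      ≈⟨ rec (suc j +ℕ m) ⟩
    k * G (suc (suc j) +ℕ m) + G (suc j +ℕ m)
      ≈⟨ +-cong (*-congˡ (addition-formula rec (suc j) m)) (addition-formula rec j m) ⟩
    k * (p₂ * y + p₁ * x) + (p₁ * y + p₀ * x)
      ≈⟨ solve 6 (λ k p₂ p₁ p₀ y x → k :* (p₂ :* y :+ p₁ :* x) :+ (p₁ :* y :+ p₀ :* x)
                   := (k :* p₂ :+ p₁) :* y :+ (k :* p₁ :+ p₀) :* x) refl k p₂ p₁ p₀ y x ⟩
    (k * p₂ + p₁) * y + (k * p₁ + p₀) * x       ∎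
    where
    y = G (suc m); x = G m
    p₂ = F k (suc (suc j)); p₁ = F k (suc j); p₀ = F k j

  cassiniForm : Carrier → Carrier → Carrier → Carrier
  cassiniForm k y x = y * y - (k * y + x) * x

  cassini-step : ∀ {k y′ y x} → y′ ≈ k * y + x → cassiniForm k y′ y ≈ - cassiniForm k y x
  cassini-step {k} {y′} {y} {x} y′≈ky+x = begin
    y′ * y′ - (k * y′ + y) * y
      ≈⟨ +-cong (*-cong y′≈ky+x y′≈ky+x) (-‿cong (*-congʳ (+-congʳ (*-congˡ y′≈ky+x)))) ⟩
    (k * y + x) * (k * y + x) - (k * (k * y + x) + y) * y
      ≈⟨ diff-transfer (solve 3 (λ k y x →
           (k :* y :+ x) :* (k :* y :+ x) :+ y :* y
             := (k :* y :+ x) :* x :+ (k :* (k :* y :+ x) :+ y) :* y) refl k y x) ⟩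
    (k * y + x) * x - y * y
      ≈⟨ sym (⁻¹-anti-homo‿- (y * y) ((k * y + x) * x)) ⟩
    - cassiniForm k y x ∎

  cassini : ∀ {k G} → Recurrent k G → ∀ m →
    cassiniForm k (G (suc m)) (G m) ≈ negOnePow m * cassiniForm k (G 1) (G 0)
  cassini rec zero = sym (*-identityˡ _)
  cassini {k} {G} rec (suc m) = begin
    cassiniForm k (G (suc (suc m))) (G (suc m))  ≈⟨ cassini-step (rec m) ⟩
    - cassiniForm k (G (suc m)) (G m)            ≈⟨ -‿cong (cassini rec m) ⟩
    - (negOnePow m * C)                          ≈⟨ sym (negOnePow-suc m C) ⟩
    negOnePow (suc m) * C                        ∎
    where C = cassiniForm k (G 1) (G 0)

  -- The core polynomial identity of Catalan's identity: with x = G(m),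
  -- y = G(m+1), p = F(r), e = F(r-1) and F(r+1) = k p + e, the Catalan
  -- difference equals -p² Q(y, x); the coefficient e cancels out.
  catalan-core : ∀ k p e y x →
    x * (p * ((k * p + e) * y + p * x) + e * (p * y + e * x)) - (p * y + e * x) * (p * y + e * x)
      ≈ - (cassiniForm k y x * (p * p))
  catalan-core k p e y x = begin
    x * (p * ((k * p + e) * y + p * x) + e * (p * y + e * x)) - (p * y + e * x) * (p * y + e * x)
      ≈⟨ diff-transfer (solve 5 (λ k p e y x →
           x :* (p :* ((k :* p :+ e) :* y :+ p :* x) :+ e :* (p :* y :+ e :* x)) :+ y :* y :* (p :* p)
             := (k :* y :+ x) :* x :* (p :* p) :+ (p :* y :+ e :* x) :* (p :* y :+ e :* x))
           refl k p e y x) ⟩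
    (k * y + x) * x * (p * p) - y * y * (p * p)
      ≈⟨ sym ([y-z]x≈yx-zx (p * p) ((k * y + x) * x) (y * y)) ⟩
    ((k * y + x) * x - y * y) * (p * p)
      ≈⟨ *-congʳ (sym (⁻¹-anti-homo‿- (y * y) ((k * y + x) * x))) ⟩
    - cassiniForm k y x * (p * p)
      ≈⟨ sym (-‿distribˡ-* (cassiniForm k y x) (p * p)) ⟩
    - (cassiniForm k y x * (p * p)) ∎

  catalan : ∀ {k G} → Recurrent k G → ∀ m r →
    G m * G (r +ℕ (r +ℕ m)) - G (r +ℕ m) * G (r +ℕ m)
      ≈ negOnePow (suc m) * (cassiniForm k (G 1) (G 0) * (F k r * F k r))
  catalan {k} {G} rec m zero = begin
    G m * G m - G m * G m                  ≈⟨ -‿inverseʳ (G m * G m) ⟩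
    0#                                     ≈⟨ sym (zeroʳ (negOnePow (suc m))) ⟩
    negOnePow (suc m) * 0#                 ≈⟨ *-congˡ (sym (zeroʳ C)) ⟩
    negOnePow (suc m) * (C * 0#)           ≈⟨ *-congˡ (*-congˡ (sym (zeroˡ 0#))) ⟩
    negOnePow (suc m) * (C * (0# * 0#))    ∎
    where C = cassiniForm k (G 1) (G 0)
  catalan {k} {G} rec m (suc j) = begin
    x * G (r +ℕ (r +ℕ m)) - G (r +ℕ m) * G (r +ℕ m)
      ≈⟨ +-cong (*-congˡ (addition-formula rec j (r +ℕ m))) (-‿cong (*-cong G[r+m] G[r+m])) ⟩
    x * (p * G (suc r +ℕ m) + e * G (r +ℕ m)) - (p * y + e * x) * (p * y + e * x)
      ≈⟨ +-congʳ (*-congˡ (+-cong (*-congˡ (addition-formula rec (suc j) m)) (*-congˡ G[r+m]))) ⟩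
    x * (p * ((k * p + e) * y + p * x) + e * (p * y + e * x)) - (p * y + e * x) * (p * y + e * x)
      ≈⟨ catalan-core k p e y x ⟩
    - (cassiniForm k y x * (p * p))
      ≈⟨ -‿cong (*-congʳ (cassini rec m)) ⟩
    - (negOnePow m * C * (p * p))
      ≈⟨ -‿cong (*-assoc (negOnePow m) C (p * p)) ⟩
    - (negOnePow m * (C * (p * p)))
      ≈⟨ sym (negOnePow-suc m (C * (p * p))) ⟩
    negOnePow (suc m) * (C * (p * p)) ∎
    where
    r = suc j; x = G m; y = G (suc m); p = F k r; e = F k j
    C = cassiniForm k (G 1) (G 0)
    G[r+m] : G (r +ℕ m) ≈ p * y + e * x
    G[r+m] = addition-formula rec j m

  catalan-centred : ∀ {k G} → Recurrent k G → ∀ n r → r ≤ n →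
    G (n ∸ r) * G (n +ℕ r) - G n * G n
      ≈ negOnePow (suc (n ∸ r)) * (cassiniForm k (G 1) (G 0) * (F k r * F k r))
  catalan-centred {k} {G} rec n r r≤n =
    subst₂ (λ i j → G (n ∸ r) * G j - G i * G i ≈ negOnePow (suc (n ∸ r)) * (C * (F k r * F k r)))
           r+m≡n r+[r+m]≡n+r (catalan rec (n ∸ r) r)
    where
    C = cassiniForm k (G 1) (G 0)
    r+m≡n : r +ℕ (n ∸ r) ≡ n
    r+m≡n = m+[n∸m]≡n r≤n
    r+[r+m]≡n+r : r +ℕ (r +ℕ (n ∸ r)) ≡ n +ℕ r
    r+[r+m]≡n+r = ≡-trans (cong (r +ℕ_) r+m≡n) (+ℕ-comm r n)

  S-recurrent : ∀ k a b → Recurrent k (S k a b)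
  S-recurrent k a b n = refl

  S-cassini : ∀ k a b → cassiniForm k (S k a b 1) (S k a b 0) ≈ a * a - (k * k + four) * (b * b)
  S-cassini k a b = diff-transfer (solve 3 (λ k a b →
    (b :* k :+ a) :* (b :* k :+ a) :+ (k :* k :+ (con 1 :+ con 1 :+ con 1 :+ con 1)) :* (b :* b)
      := a :* a :+ (k :* (b :* k :+ a) :+ (con 1 :+ con 1) :* b) :* ((con 1 :+ con 1) :* b))
    refl k a b)

mainTheorem8 : ∀ {c ℓ : Level} (R : CommutativeRing c ℓ) →
    let open CommutativeRing R in
    let open KSeq R in
    (k a b : Carrier) (n r : ℕ) → r ≤ n →
    S k a b (n ∸ r) * S k a b (n +ℕ r) - S k a b n * S k a b n
      ≈ negOnePow (suc (n ∸ r)) * ((a * a - (k * k + four) * (b * b)) * (F k r * F k r))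
mainTheorem8 R k a b n r r≤n =
  trans (catalan-centred (S-recurrent k a b) n r r≤n)
        (*-congˡ (*-congʳ (S-cassini k a b)))
  where
  open CommutativeRing R
  open CatalanIdentity R
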